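{- Let $G$ be an undirected multigraph with minimum degree at least $3$ and let $(C,F)$ be an FVC in $G$. Then $|F|\le e(C,F)$.
   Context: Graphs are undirected multigraphs, possibly with self-loops and parallel edges; the degree of a vertex is the number of edge-endpoints incident to it, a self-loop contributing two. For disjoint vertex sets $X,Y$, $e(X,Y)$ is the number of edges with one endpoint in $X$ and the other in $Y$. A feedback vertex cut (FVC) in $G$ is a pair of disjoint sets $C,F\subseteq V(G)$ such that $G[F]$ is a forest and every tree $T$ of $G[F]$ satisfies $e(V(T),V(G)\setminus(C\cup F))\le1$. -}

module Defs where

open import Data.Nat using (ℕ; zero; suc; _+_; _≤_)
open import Data.Bool using (Bool; true; false; _∧_; _∨_; if_then_else_)
open import Data.Fin using (Fin; zero; suc; inject₁; fromℕ; _≟_)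
open import Data.Fin.Subset using (Subset; _∈_; _∉_; ∣_∣)
open import Data.Vec using (lookup)
open import Data.Product using (_×_; _,_; proj₁; proj₂; Σ; ∃)
open import Data.Sum using (_⊎_)
open import Relation.Binary.PropositionalEquality using (_≡_)
open import Relation.Nullary.Decidable using (⌊_⌋)
open import Relation.Nullary using (¬_)
open import Function.Definitions using (Injective)

-- A finite undirected multigraph (loops and parallel edges allowed):
-- vertices Fin n, edges Fin m, each edge given by its pair of endpoints.
record Multigraph : Set where
  field
    n : ℕ
    m : ℕ
    ends : Fin m → Fin n × Fin n

open Multigraph public

count : ∀ {k} → (Fin k → Bool) → ℕ
count {zero}  f = 0
count {suc k} f = (if f zero then 1 else 0) + count (λ i → f (suc i))

sumFin : ∀ {k} → (Fin k → ℕ) → ℕ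
sumFin {zero}  f = 0
sumFin {suc k} f = f zero + sumFin (λ i → f (suc i))

-- degree: number of edge-endpoints at v (a loop contributes 2)
degree : (G : Multigraph) → Fin (n G) → ℕ
degree G v = sumFin (λ i →
  (if ⌊ proj₁ (ends G i) ≟ v ⌋ then 1 else 0) +
  (if ⌊ proj₂ (ends G i) ≟ v ⌋ then 1 else 0))

Joins : (G : Multigraph) → Fin (m G) → Fin (n G) → Fin (n G) → Set
Joins G i a b = ends G i ≡ (a , b) ⊎ ends G i ≡ (b , a)

InInduced : (G : Multigraph) → Subset (n G) → Fin (m G) → Set
InInduced G F i = proj₁ (ends G i) ∈ F × proj₂ (ends G i) ∈ F

-- a cycle in G[F] of length k+1: distinct vertices vs 0..k, distinct edges
-- es 0..k of G[F], es j joining vs j and vs (j+1 mod k+1)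
record Cycle (G : Multigraph) (F : Subset (n G)) : Set where
  field
    k   : ℕ
    vs  : Fin (suc k) → Fin (n G)
    es  : Fin (suc k) → Fin (m G)
    vs-inj : Injective _≡_ _≡_ vs
    es-inj : Injective _≡_ _≡_ es
    es-in  : ∀ j → InInduced G F (es j)
    step   : ∀ (j : Fin k) → Joins G (es (inject₁ j)) (vs (inject₁ j)) (vs (suc j))
    close  : Joins G (es (fromℕ k)) (vs (fromℕ k)) (vs zero)

IsForest : (G : Multigraph) → Subset (n G) → Set
IsForest G F = ¬ Cycle G F

-- u reaches w by a walk in G[F] (u, w assumed in F)
data Reach (G : Multigraph) (F : Subset (n G)) (u : Fin (n G)) : Fin (n G) → Set where
  here : Reach G F u u
  step : ∀ {w x} (i : Fin (m G)) → Reach G F u w → InInduced G F i → Joins G i w x → Reach G F u x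

-- vertex u lies in the tree (component) of G[F] containing v ∈ F
InTreeOf : (G : Multigraph) → Subset (n G) → Fin (n G) → Fin (n G) → Set
InTreeOf G F v u = u ∈ F × Reach G F v u

LeavesTree : (G : Multigraph) → Subset (n G) → Subset (n G) → Fin (n G) → Fin (m G) → Set
LeavesTree G C F v i = Σ (Fin (n G)) λ a → Σ (Fin (n G)) λ b →
  Joins G i a b × InTreeOf G F v a × b ∉ C × b ∉ F

IsFVC : (G : Multigraph) → Subset (n G) → Subset (n G) → Set
IsFVC G C F =
  (∀ v → v ∈ C → v ∉ F) ×
  IsForest G F ×
  (∀ v → v ∈ F → ∀ i j → LeavesTree G C F v i → LeavesTree G C F v j → i ≡ j)

eBetween : (G : Multigraph) → Subset (n G) → Subset (n G) → ℕ
eBetween G C F = count λ i →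
  let a = proj₁ (ends G i) ; b = proj₂ (ends G i) in
  (lookup C a ∧ lookup F b) ∨ (lookup F a ∧ lookup C b)

-- As δ(G) ≥ 3, 3|F| ≤ Σ_{v∈F} deg v ≤ 2 (e(F) + e(F,R)) + e(C,F) with R = V ∖ (C ∪ F),
-- so it suffices that e(S) + e(S,R) ≤ |S| for every S ⊆ F.  By induction on |S|, a vertex of
-- S with at most one edge into S ∪ R can be deleted.  Otherwise a walk in G[S] that never
-- leaves a vertex by the edge it arrived on cannot revisit a vertex without closing a cycle
-- in the forest G[F], so it must stop at an edge into R.  Starting it at the S-end of such an
-- edge, and forbidding that edge, yields two edges from one tree of G[F] into R, contradicting
-- the FVC condition.

module Submission where

open import Defs
open import Data.Bool using (Bool; true; false; T; not; _∧_; _∨_; if_then_else_)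
open import Data.Bool.Properties using (T-∧; T-∨; T-≡; ∧-zeroʳ; ∧-identityʳ)
open import Data.Empty using (⊥; ⊥-elim)
open import Data.Fin using (Fin; zero; suc; toℕ; fromℕ; fromℕ<; inject₁; _≟_)
open import Data.Fin.Properties
  using (any?; pigeonhole; toℕ-injective; toℕ<n; toℕ≤pred[n]; toℕ-fromℕ<; toℕ-fromℕ; toℕ-inject₁)
open import Data.Fin.Subset using (Subset; ∣_∣; _∈_; _∉_; inside; outside)
open import Data.Nat using (ℕ; zero; suc; _+_; _*_; _≤_; _<_; _≤ᵇ_; z≤n; s≤s)
open import Data.Nat.Properties hiding (_≟_)
open import Data.Nat.Properties using () renaming (_≟_ to _≟ℕ_)
open import Algebra.Properties.CommutativeSemigroup +-commutativeSemigroup using (interchange; x∙yz≈y∙xz)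
open import Data.Product using (_×_; _,_; proj₁; proj₂; ∃; ∃₂)
open import Data.Product.Properties using (,-injective)
open import Data.Sum using (_⊎_; inj₁; inj₂)
open import Data.Vec using (Vec; []; _∷_; lookup)
open import Data.Vec.Properties using ([]=⇒lookup; lookup⇒[]=)
open import Function using (_∘_)
open import Function.Bundles using (Equivalence)
open import Relation.Binary.PropositionalEquality
open import Relation.Nullary using (¬_; yes; no)
open import Relation.Nullary.Decidable using (⌊_⌋; _×-dec_; T?; toWitness; fromWitness)

open Equivalence using (to; from)

T-not : ∀ {b} → T (not b) → ¬ T b
T-not {true}  () _
T-not {false} _ ()

_∪ᵇ_ _∖ᵇ_ : {A : Set} → (A → Bool) → (A → Bool) → A → Bool
(X ∪ᵇ Y) x = X x ∨ Y x
(X ∖ᵇ Y) x = X x ∧ not (Y x)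

⁅_⁆ᵇ : ∀ {k} → Fin k → Fin k → Bool
⁅ j ⁆ᵇ i = ⌊ i ≟ j ⌋

⌊suc≟suc⌋ : ∀ {k} (i j : Fin k) → ⌊ suc i ≟ suc j ⌋ ≡ ⌊ i ≟ j ⌋
⌊suc≟suc⌋ i j with i ≟ j
... | yes _ = refl
... | no  _ = refl

∈⇒T : ∀ {k} {p : Subset k} {i} → i ∈ p → T (lookup p i)
∈⇒T i∈p = from T-≡ ([]=⇒lookup i∈p)

T⇒∈ : ∀ {k} {p : Subset k} {i} → T (lookup p i) → i ∈ p
T⇒∈ {p = p} {i} t = lookup⇒[]= i p (to T-≡ t)

-- Lets a finite truth table be proved by evaluation: T (tautology k φ) reduces to ⊤.
tautology : ∀ k → (Vec Bool k → Bool) → Bool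
tautology zero    φ = φ []
tautology (suc k) φ = tautology k (φ ∘ (true ∷_)) ∧ tautology k (φ ∘ (false ∷_))

tautology⇒T : ∀ k (φ : Vec Bool k → Bool) → T (tautology k φ) → ∀ xs → T (φ xs)
tautology⇒T zero    φ h []           = h
tautology⇒T (suc k) φ h (true  ∷ xs) = tautology⇒T k _ (proj₁ (to T-∧ h)) xs
tautology⇒T (suc k) φ h (false ∷ xs) = tautology⇒T k _ (proj₂ (to T-∧ h)) xs

_∷ˢ_ : {A : Set} → A → (ℕ → A) → ℕ → A
(x ∷ˢ f) zero    = x
(x ∷ˢ f) (suc a) = f a

indicator : Bool → ℕ
indicator b = if b then 1 else 0

indicator≤1 : ∀ b → indicator b ≤ 1
indicator≤1 true  = ≤-refl
indicator≤1 false = z≤n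

*-indicator-≤ : ∀ {d m} b → (T b → d ≤ m) → d * indicator b ≤ (if b then m else 0)
*-indicator-≤ {d} true  le = ≤-trans (≤-reflexive (*-identityʳ d)) (le _)
*-indicator-≤ {d} false _  = ≤-reflexive (*-zeroʳ d)

if-indicator-+ : ∀ b x y →
  (if b then indicator x + indicator y else 0) ≡
  (if x then indicator b else 0) + (if y then indicator b else 0)
if-indicator-+ true  x     y     = refl
if-indicator-+ false true  true  = refl
if-indicator-+ false true  false = refl
if-indicator-+ false false true  = refl
if-indicator-+ false false false = refl

sumFin-cong : ∀ {k} {f g : Fin k → ℕ} → (∀ i → f i ≡ g i) → sumFin f ≡ sumFin g
sumFin-cong {zero}  eq = refl
sumFin-cong {suc k} eq = cong₂ _+_ (eq zero) (sumFin-cong (eq ∘ suc))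

sumFin-mono : ∀ {k} {f g : Fin k → ℕ} → (∀ i → f i ≤ g i) → sumFin f ≤ sumFin g
sumFin-mono {zero}  le = z≤n
sumFin-mono {suc k} le = +-mono-≤ (le zero) (sumFin-mono (le ∘ suc))

sumFin-zero : ∀ k → sumFin {k} (λ _ → 0) ≡ 0
sumFin-zero zero    = refl
sumFin-zero (suc k) = sumFin-zero k

sumFin-+ : ∀ {k} (f g : Fin k → ℕ) → sumFin (λ i → f i + g i) ≡ sumFin f + sumFin g
sumFin-+ {zero}  f g = refl
sumFin-+ {suc k} f g = trans (cong (f zero + g zero +_) (sumFin-+ (f ∘ suc) (g ∘ suc)))
                             (interchange (f zero) (g zero) _ _)

sumFin-*ˡ : ∀ {k} c (f : Fin k → ℕ) → sumFin (λ i → c * f i) ≡ c * sumFin f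
sumFin-*ˡ {zero}  c f = sym (*-zeroʳ c)
sumFin-*ˡ {suc k} c f = trans (cong (c * f zero +_) (sumFin-*ˡ c (f ∘ suc)))
                              (sym (*-distribˡ-+ c (f zero) _))

if-sumFin : ∀ {k} b (f : Fin k → ℕ) → (if b then sumFin f else 0) ≡ sumFin (λ i → if b then f i else 0)
if-sumFin     true  f = refl
if-sumFin {k} false f = sym (sumFin-zero k)

sumFin-swap : ∀ {k l} (f : Fin k → Fin l → ℕ) →
  sumFin (λ i → sumFin (f i)) ≡ sumFin (λ j → sumFin (λ i → f i j))
sumFin-swap {zero}  {l} f = sym (sumFin-zero l)
sumFin-swap {suc k}     f = trans (cong (sumFin (f zero) +_) (sumFin-swap (f ∘ suc)))
                                  (sym (sumFin-+ (f zero) _))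

sumFin-point : ∀ {k} (a : Fin k) (f : Fin k → ℕ) → sumFin (λ i → if ⌊ a ≟ i ⌋ then f i else 0) ≡ f a
sumFin-point {suc k} zero    f = trans (cong (f zero +_) (sumFin-zero k)) (+-identityʳ (f zero))
sumFin-point {suc k} (suc a) f =
  trans (sumFin-cong (λ i → cong (λ b → if b then f (suc i) else 0) (⌊suc≟suc⌋ a i)))
        (sumFin-point a (f ∘ suc))

count≡sumFin : ∀ {k} (f : Fin k → Bool) → count f ≡ sumFin (indicator ∘ f)
count≡sumFin {zero}  f = refl
count≡sumFin {suc k} f = cong (indicator (f zero) +_) (count≡sumFin (f ∘ suc))

count-cong : ∀ {k} {f g : Fin k → Bool} → (∀ i → f i ≡ g i) → count f ≡ count g
count-cong {zero}  eq = refl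
count-cong {suc k} eq = cong₂ _+_ (cong indicator (eq zero)) (count-cong (eq ∘ suc))

count-≤-+ : ∀ {k} (f g h : Fin k → Bool) →
  (∀ i → indicator (f i) ≤ indicator (g i) + indicator (h i)) → count f ≤ count g + count h
count-≤-+ f g h le = begin
  count f                                          ≡⟨ count≡sumFin f ⟩
  sumFin (indicator ∘ f)                           ≤⟨ sumFin-mono le ⟩
  sumFin (λ i → indicator (g i) + indicator (h i)) ≡⟨ sumFin-+ (indicator ∘ g) (indicator ∘ h) ⟩
  sumFin (indicator ∘ g) + sumFin (indicator ∘ h)  ≡⟨ sym (cong₂ _+_ (count≡sumFin g) (count≡sumFin h)) ⟩
  count g + count h                                ∎
  where open ≤-Reasoning

count-split : ∀ {k} (f : Fin k → Bool) j → count f ≡ indicator (f j) + count (f ∖ᵇ ⁅ j ⁆ᵇ)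
count-split {suc k} f zero = cong (indicator (f zero) +_) (sym (cong₂ (λ b c → indicator b + c)
  (∧-zeroʳ (f zero)) (count-cong (λ i → ∧-identityʳ (f (suc i))))))
count-split {suc k} f (suc j) = begin
  indicator (f zero) + count (f ∘ suc)
    ≡⟨ cong (indicator (f zero) +_) (count-split (f ∘ suc) j) ⟩
  indicator (f zero) + (indicator (f (suc j)) + count ((f ∘ suc) ∖ᵇ ⁅ j ⁆ᵇ))
    ≡⟨ x∙yz≈y∙xz (indicator (f zero)) (indicator (f (suc j))) _ ⟩
  indicator (f (suc j)) + (indicator (f zero) + count ((f ∘ suc) ∖ᵇ ⁅ j ⁆ᵇ))
    ≡⟨ cong (indicator (f (suc j)) +_) (sym (cong₂ (λ b c → indicator b + c)
         (∧-identityʳ (f zero))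
         (count-cong (λ i → cong (λ b → f (suc i) ∧ not b) (⌊suc≟suc⌋ i j))))) ⟩
  indicator (f (suc j)) + count (f ∖ᵇ ⁅ suc j ⁆ᵇ) ∎
  where open ≡-Reasoning

count-remove : ∀ {k} (f : Fin k → Bool) {j} → T (f j) → count f ≡ suc (count (f ∖ᵇ ⁅ j ⁆ᵇ))
count-remove f {j} t with f j in eq
... | true = trans (count-split f j) (cong (λ b → indicator b + count (f ∖ᵇ ⁅ j ⁆ᵇ)) eq)

T⇒0<count : ∀ {k} (f : Fin k → Bool) {i} → T (f i) → 0 < count f
T⇒0<count f {zero} t with f zero
... | true = s≤s z≤n
T⇒0<count f {suc i} t = ≤-trans (T⇒0<count (f ∘ suc) t) (m≤n+m _ (indicator (f zero)))

count-witness : ∀ {k} (f : Fin k → Bool) → 0 < count f → ∃ λ i → T (f i)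
count-witness {suc k} f pos with f zero in eq
... | true  = zero , from T-≡ eq
... | false = let i , t = count-witness (f ∘ suc) pos in suc i , t

count-witness-≢ : ∀ {k} (f : Fin k → Bool) j → 2 ≤ count f → ∃ λ i → i ≢ j × T (f i)
count-witness-≢ f j two with count-witness (f ∖ᵇ ⁅ j ⁆ᵇ) rest-pos
  where
  rest-pos : 0 < count (f ∖ᵇ ⁅ j ⁆ᵇ)
  rest-pos = +-cancelˡ-≤ 1 _ _ (≤-trans two (≤-trans (≤-reflexive (count-split f j))
                                                      (+-monoˡ-≤ _ (indicator≤1 (f j)))))
... | i , t = let fi , i≢j = to T-∧ t in i , (λ i≡j → T-not i≢j (fromWitness i≡j)) , fi

∣p∣≡count : ∀ {k} (p : Subset k) → ∣ p ∣ ≡ count (lookup p)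
∣p∣≡count []            = refl
∣p∣≡count (outside ∷ p) = ∣p∣≡count p
∣p∣≡count (inside  ∷ p) = cong suc (∣p∣≡count p)

*-count-≤ : ∀ {k} d (X : Fin k → Bool) (f : Fin k → ℕ) → (∀ i → T (X i) → d ≤ f i) →
  d * count X ≤ sumFin (λ i → if X i then f i else 0)
*-count-≤ {zero}  d X f le = ≤-reflexive (*-zeroʳ d)
*-count-≤ {suc k} d X f le = begin
  d * (indicator (X zero) + count (X ∘ suc))     ≡⟨ *-distribˡ-+ d _ _ ⟩
  d * indicator (X zero) + d * count (X ∘ suc)   ≤⟨ +-mono-≤ (*-indicator-≤ (X zero) (le zero))
                                                              (*-count-≤ d (X ∘ suc) (f ∘ suc) (le ∘ suc)) ⟩
  sumFin (λ i → if X i then f i else 0)          ∎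
  where open ≤-Reasoning

module Graph (G : Multigraph) where

  Vertex Edge : Set
  Vertex = Fin (n G)
  Edge   = Fin (m G)

  end₁ end₂ : Edge → Vertex
  end₁ i = proj₁ (ends G i)
  end₂ i = proj₂ (ends G i)

  link : (x₁ x₂ y₁ y₂ : Bool) → Bool
  link x₁ x₂ y₁ y₂ = (x₁ ∧ y₂) ∨ (x₂ ∧ y₁)

  links : (Vertex → Bool) → (Vertex → Bool) → Edge → Bool
  links X Y i = link (X (end₁ i)) (X (end₂ i)) (Y (end₁ i)) (Y (end₂ i))

  Joins-sym : ∀ {i a b} → Joins G i a b → Joins G i b a
  Joins-sym (inj₁ eq) = inj₂ eq
  Joins-sym (inj₂ eq) = inj₁ eq

  Joins-endpoints : ∀ {i a b c d} → Joins G i a b → Joins G i c d → (a ≡ c × b ≡ d) ⊎ (a ≡ d × b ≡ c)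
  Joins-endpoints (inj₁ p) (inj₁ q) = inj₁ (,-injective (trans (sym p) q))
  Joins-endpoints (inj₁ p) (inj₂ q) = inj₂ (,-injective (trans (sym p) q))
  Joins-endpoints (inj₂ p) (inj₁ q) = let b≡c , a≡d = ,-injective (trans (sym p) q) in inj₂ (a≡d , b≡c)
  Joins-endpoints (inj₂ p) (inj₂ q) = let b≡d , a≡c = ,-injective (trans (sym p) q) in inj₁ (a≡c , b≡d)

  Joins⇒InInduced : ∀ {F i a b} → Joins G i a b → a ∈ F → b ∈ F → InInduced G F i
  Joins⇒InInduced (inj₁ eq) a∈F b∈F rewrite eq = a∈F , b∈F
  Joins⇒InInduced (inj₂ eq) a∈F b∈F rewrite eq = b∈F , a∈F

  links⇒Joins : ∀ {X Y i} → T (links X Y i) → ∃₂ λ a b → Joins G i a b × T (X a) × T (Y b)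
  links⇒Joins {i = i} t with to T-∨ t
  ... | inj₁ t₁ = let Xa , Yb = to T-∧ t₁ in end₁ i , end₂ i , inj₁ refl , Xa , Yb
  ... | inj₂ t₂ = let Xa , Yb = to T-∧ t₂ in end₂ i , end₁ i , inj₂ refl , Xa , Yb

  links-⁅⁆⇒Joins : ∀ {v Y i} → T (links ⁅ v ⁆ᵇ Y i) → ∃ λ w → Joins G i v w × T (Y w)
  links-⁅⁆⇒Joins {v} {Y} t with links⇒Joins {⁅ v ⁆ᵇ} {Y} t
  ... | a , w , J , a≡v , Yw = w , subst (λ x → Joins G _ x w) (toWitness {a? = a ≟ v} a≡v) J , Yw

  handshake : (X : Vertex → Bool) →
    sumFin (λ v → if X v then degree G v else 0) ≡
    sumFin (λ i → indicator (X (end₁ i)) + indicator (X (end₂ i)))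
  handshake X = begin
    sumFin (λ v → if X v then degree G v else 0)
      ≡⟨ sumFin-cong (λ v → if-sumFin (X v) (λ i → incidence i v)) ⟩
    sumFin (λ v → sumFin (λ i → if X v then incidence i v else 0))
      ≡⟨ sumFin-swap (λ v i → if X v then incidence i v else 0) ⟩
    sumFin (λ i → sumFin (λ v → if X v then incidence i v else 0))
      ≡⟨ sumFin-cong (λ i → sumFin-cong (λ v → if-indicator-+ (X v) ⌊ end₁ i ≟ v ⌋ ⌊ end₂ i ≟ v ⌋)) ⟩
    sumFin (λ i → sumFin (λ v → at (end₁ i) v + at (end₂ i) v))
      ≡⟨ sumFin-cong (λ i → sumFin-+ (at (end₁ i)) (at (end₂ i))) ⟩
    sumFin (λ i → sumFin (at (end₁ i)) + sumFin (at (end₂ i)))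
      ≡⟨ sumFin-cong (λ i → cong₂ _+_ (sumFin-point (end₁ i) _) (sumFin-point (end₂ i) _)) ⟩
    sumFin (λ i → indicator (X (end₁ i)) + indicator (X (end₂ i))) ∎
    where
    open ≡-Reasoning
    incidence : Edge → Vertex → ℕ
    incidence i v = indicator ⌊ end₁ i ≟ v ⌋ + indicator ⌊ end₂ i ≟ v ⌋
    at : Vertex → Vertex → ℕ
    at a v = if ⌊ a ≟ v ⌋ then indicator (X v) else 0

  links-∖ : ∀ S Z D i →
    indicator (links S (S ∪ᵇ Z) i) ≤
    indicator (links (S ∖ᵇ D) ((S ∖ᵇ D) ∪ᵇ Z) i) + indicator (links D (S ∪ᵇ Z) i)
  links-∖ S Z D i = ≤ᵇ⇒≤ _ _ (tautology⇒T 6 table _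
    (S (end₁ i) ∷ S (end₂ i) ∷ Z (end₁ i) ∷ Z (end₂ i) ∷ D (end₁ i) ∷ D (end₂ i) ∷ []))
    where
    table : Vec Bool 6 → Bool
    table (s₁ ∷ s₂ ∷ z₁ ∷ z₂ ∷ d₁ ∷ d₂ ∷ []) =
      indicator (link s₁ s₂ (s₁ ∨ z₁) (s₂ ∨ z₂)) ≤ᵇ
      indicator (link (s₁ ∧ not d₁) (s₂ ∧ not d₂) ((s₁ ∧ not d₁) ∨ z₁) ((s₂ ∧ not d₂) ∨ z₂)) +
      indicator (link d₁ d₂ (s₁ ∨ z₁) (s₂ ∨ z₂))

  module Walk {F : Subset (n G)} (forest : IsForest G F)
              (S Z : Vertex → Bool) (S⊆F : ∀ {v} → T (S v) → v ∈ F)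
              (branching : ∀ {v} → T (S v) → 2 ≤ count (links ⁅ v ⁆ᵇ (S ∪ᵇ Z)))
              (u : Vertex) (forbidden : Edge) where

    -- A path in G[S] from the tip, vertex 0, back to vertex len = u.  Edge 0 is the edge by
    -- which the tip was entered; for the empty trail it is the forbidden edge, so the walk
    -- never leaves u along it.
    record Trail : Set where
      field
        len              : ℕ
        vertex           : ℕ → Vertex
        edge             : ℕ → Edge
        vertex-injective : ∀ {a b} → a ≤ len → b ≤ len → vertex a ≡ vertex b → a ≡ b
        vertex∈S         : ∀ {a} → a ≤ len → T (S (vertex a))
        edge-joins       : ∀ {a} → a < len → Joins G (edge a) (vertex a) (vertex (suc a))
        edge-injective   : ∀ {a b} → a < len → b < len → edge a ≡ edge b → a ≡ b
        ends-at-u        : vertex len ≡ u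
        edge₀-forbidden  : len ≡ 0 → edge 0 ≡ forbidden
        reaches-tip      : Reach G F u (vertex 0)

    record Exit : Set where
      field
        vertex   : Vertex
        edge     : Edge
        target   : Vertex
        joins    : Joins G edge vertex target
        vertex∈S : T (S vertex)
        target∈Z : T (Z target)
        reaches  : Reach G F u vertex
        fresh    : vertex ≡ u → edge ≢ forbidden

    trivial : T (S u) → Trail
    trivial u∈S = record
      { len              = 0
      ; vertex           = λ _ → u
      ; edge             = λ _ → forbidden
      ; vertex-injective = λ { z≤n z≤n _ → refl }
      ; vertex∈S         = λ _ → u∈S
      ; edge-joins       = λ ()
      ; edge-injective   = λ ()
      ; ends-at-u        = refl
      ; edge₀-forbidden  = λ _ → refl
      ; reaches-tip      = here
      }

    module _ (t : Trail) where
      open Trail t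

      len<n : len < n G
      len<n = ≰⇒> λ n≤len →
        let i , j , i<j , vi≡vj = pigeonhole (s≤s n≤len) (vertex ∘ toℕ)
        in <⇒≢ i<j (vertex-injective (toℕ≤pred[n] i) (toℕ≤pred[n] j) vi≡vj)

      close-cycle : ∀ {e w p} → Joins G e (vertex 0) w → e ≢ edge 0 → T (S w) →
                    p ≤ len → vertex p ≡ w → Cycle G F
      close-cycle {e} {w} {p} J e≢edge₀ w∈S p≤len vp≡w = record
        { k      = p
        ; vs     = vertex ∘ toℕ
        ; es     = cycle-edge ∘ toℕ
        ; vs-inj = λ {a} {b} eq → toℕ-injective (vertex-injective (bound a) (bound b) eq)
        ; es-inj = λ {a} {b} eq → toℕ-injective
                     (cycle-edge-injective (toℕ≤pred[n] a) (toℕ≤pred[n] b) eq)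
        ; es-in  = λ j → cycle-edge-induced (toℕ≤pred[n] j)
        ; step   = path-step
        ; close  = closing-step
        }
        where
        bound : (j : Fin (suc p)) → toℕ j ≤ len
        bound j = ≤-trans (toℕ≤pred[n] j) p≤len

        cycle-edge : ℕ → Edge
        cycle-edge a with a ≟ℕ p
        ... | yes _ = e
        ... | no  _ = edge a

        cycle-edge-p : cycle-edge p ≡ e
        cycle-edge-p with p ≟ℕ p
        ... | yes _   = refl
        ... | no  p≢p = ⊥-elim (p≢p refl)

        cycle-edge-< : ∀ {a} → a < p → cycle-edge a ≡ edge a
        cycle-edge-< {a} a<p with a ≟ℕ p
        ... | yes a≡p = ⊥-elim (<-irrefl a≡p a<p)
        ... | no  _   = refl

        e-fresh : ∀ {a} → a < p → e ≢ edge a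
        e-fresh {a} a<p e≡edge-a
          with Joins-endpoints (subst (λ i → Joins G i (vertex 0) w) e≡edge-a J)
                               (edge-joins (<-≤-trans a<p p≤len))
        ... | inj₁ (v₀≡va , _) =
          e≢edge₀ (trans e≡edge-a (cong edge (sym (vertex-injective z≤n (<⇒≤ (<-≤-trans a<p p≤len)) v₀≡va))))
        ... | inj₂ (v₀≡vsa , _) with vertex-injective z≤n (<-≤-trans a<p p≤len) v₀≡vsa
        ... | ()

        cycle-edge-injective : ∀ {a b} → a ≤ p → b ≤ p → cycle-edge a ≡ cycle-edge b → a ≡ b
        cycle-edge-injective {a} {b} a≤p b≤p eq with a ≟ℕ p | b ≟ℕ p
        ... | yes a≡p | yes b≡p = trans a≡p (sym b≡p)
        ... | yes _   | no  b≢p = ⊥-elim (e-fresh (≤∧≢⇒< b≤p b≢p) eq)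
        ... | no  a≢p | yes _   = ⊥-elim (e-fresh (≤∧≢⇒< a≤p a≢p) (sym eq))
        ... | no  a≢p | no  b≢p = edge-injective (<-≤-trans (≤∧≢⇒< a≤p a≢p) p≤len)
                                                 (<-≤-trans (≤∧≢⇒< b≤p b≢p) p≤len) eq

        cycle-edge-induced : ∀ {a} → a ≤ p → InInduced G F (cycle-edge a)
        cycle-edge-induced {a} a≤p with a ≟ℕ p
        ... | yes _ = Joins⇒InInduced J (S⊆F (vertex∈S z≤n)) (S⊆F w∈S)
        ... | no a≢p = let a<len = <-≤-trans (≤∧≢⇒< a≤p a≢p) p≤len in
          Joins⇒InInduced (edge-joins a<len) (S⊆F (vertex∈S (<⇒≤ a<len))) (S⊆F (vertex∈S a<len))

        path-step : ∀ (j : Fin p) →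
          Joins G (cycle-edge (toℕ (inject₁ j))) (vertex (toℕ (inject₁ j))) (vertex (suc (toℕ j)))
        path-step j rewrite toℕ-inject₁ j | cycle-edge-< (toℕ<n j) =
          edge-joins (<-≤-trans (toℕ<n j) p≤len)

        closing-step : Joins G (cycle-edge (toℕ (fromℕ p))) (vertex (toℕ (fromℕ p))) (vertex 0)
        closing-step rewrite toℕ-fromℕ p | cycle-edge-p | vp≡w = Joins-sym J

      extend : ∀ {e w} → Joins G e (vertex 0) w → T (S w) → (∀ {a} → a ≤ len → vertex a ≢ w) → Trail
      extend {e} {w} J w∈S w-new = record
        { len              = suc len
        ; vertex           = w ∷ˢ vertex
        ; edge             = e ∷ˢ edge
        ; vertex-injective = vertex-injective′
        ; vertex∈S         = vertex∈S′
        ; edge-joins       = edge-joins′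
        ; edge-injective   = edge-injective′
        ; ends-at-u        = ends-at-u
        ; edge₀-forbidden  = λ ()
        ; reaches-tip      = step e reaches-tip (Joins⇒InInduced J (S⊆F (vertex∈S z≤n)) (S⊆F w∈S)) J
        }
        where
        vertex-injective′ : ∀ {a b} → a ≤ suc len → b ≤ suc len → (w ∷ˢ vertex) a ≡ (w ∷ˢ vertex) b → a ≡ b
        vertex-injective′ {zero}  {zero}  _         _         _  = refl
        vertex-injective′ {zero}  {suc b} _         (s≤s b≤len) eq = ⊥-elim (w-new b≤len (sym eq))
        vertex-injective′ {suc a} {zero}  (s≤s a≤len) _         eq = ⊥-elim (w-new a≤len eq)
        vertex-injective′ {suc a} {suc b} (s≤s a≤len) (s≤s b≤len) eq = cong suc (vertex-injective a≤len b≤len eq)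

        vertex∈S′ : ∀ {a} → a ≤ suc len → T (S ((w ∷ˢ vertex) a))
        vertex∈S′ {zero}  _           = w∈S
        vertex∈S′ {suc a} (s≤s a≤len) = vertex∈S a≤len

        edge-joins′ : ∀ {a} → a < suc len → Joins G ((e ∷ˢ edge) a) ((w ∷ˢ vertex) a) ((w ∷ˢ vertex) (suc a))
        edge-joins′ {zero}  _           = Joins-sym J
        edge-joins′ {suc a} (s≤s a<len) = edge-joins a<len

        e-fresh : ∀ {a} → a < len → e ≢ edge a
        e-fresh {a} a<len e≡edge-a
          with Joins-endpoints (subst (λ i → Joins G i (vertex 0) w) e≡edge-a J) (edge-joins a<len)
        ... | inj₁ (_ , w≡vsa) = w-new a<len (sym w≡vsa)
        ... | inj₂ (_ , w≡va)  = w-new (<⇒≤ a<len) (sym w≡va)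

        edge-injective′ : ∀ {a b} → a < suc len → b < suc len → (e ∷ˢ edge) a ≡ (e ∷ˢ edge) b → a ≡ b
        edge-injective′ {zero}  {zero}  _           _           _  = refl
        edge-injective′ {zero}  {suc b} _           (s≤s b<len) eq = ⊥-elim (e-fresh b<len eq)
        edge-injective′ {suc a} {zero}  (s≤s a<len) _           eq = ⊥-elim (e-fresh a<len (sym eq))
        edge-injective′ {suc a} {suc b} (s≤s a<len) (s≤s b<len) eq = cong suc (edge-injective a<len b<len eq)

      advance : Exit ⊎ ∃ λ (t′ : Trail) → Trail.len t′ ≡ suc len
      advance with count-witness-≢ (links ⁅ vertex 0 ⁆ᵇ (S ∪ᵇ Z)) (edge 0) (branching (vertex∈S z≤n))
      ... | e , e≢edge₀ , ℓ with links-⁅⁆⇒Joins ℓ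
      ... | w , J , w∈S∪Z with to T-∨ w∈S∪Z
      ... | inj₂ w∈Z = inj₁ record
        { vertex   = vertex 0
        ; edge     = e
        ; target   = w
        ; joins    = J
        ; vertex∈S = vertex∈S z≤n
        ; target∈Z = w∈Z
        ; reaches  = reaches-tip
        ; fresh    = λ tip≡u e≡forbidden → e≢edge₀ (trans e≡forbidden (sym (edge₀-forbidden
                      (sym (vertex-injective z≤n ≤-refl (trans tip≡u (sym ends-at-u)))))))
        }
      ... | inj₁ w∈S with any? (λ (p : Fin (suc len)) → vertex (toℕ p) ≟ w)
      ...   | yes (p , vp≡w) = ⊥-elim (forest (close-cycle J e≢edge₀ w∈S (toℕ≤pred[n] p) vp≡w))
      ...   | no  w-new      = inj₂ (extend J w∈S (λ a≤len va≡w →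
                                 w-new (fromℕ< (s≤s a≤len) , trans (cong vertex (toℕ-fromℕ< _)) va≡w)) , refl)

    walk : ∀ fuel (t : Trail) → n G ≤ fuel + Trail.len t → Exit
    walk zero        t n≤len = ⊥-elim (<⇒≱ (len<n t) n≤len)
    walk (suc fuel) t n≤ with advance t
    ... | inj₁ exit       = exit
    ... | inj₂ (t′ , len′) = walk fuel t′
          (≤-trans n≤ (≤-reflexive (trans (sym (+-suc fuel _)) (cong (fuel +_) (sym len′)))))

    escape : T (S u) → Exit
    escape u∈S = walk (n G) (trivial u∈S) (m≤m+n (n G) 0)

  module Cut (C F : Subset (n G)) where

    R : Vertex → Bool
    R v = not (lookup C v) ∧ not (lookup F v)

    R⇒∉C : ∀ {v} → T (R v) → v ∉ C
    R⇒∉C Rv v∈C = T-not (proj₁ (to T-∧ Rv)) (∈⇒T v∈C)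

    R⇒∉F : ∀ {v} → T (R v) → v ∉ F
    R⇒∉F Rv v∈F = T-not (proj₂ (to T-∧ Rv)) (∈⇒T v∈F)

    UniqueExit : Set
    UniqueExit = ∀ v → v ∈ F → ∀ i j → LeavesTree G C F v i → LeavesTree G C F v j → i ≡ j

    module _ (forest : IsForest G F) (unique-exit : UniqueExit) where

      module _ (S : Vertex → Bool) (S⊆F : ∀ {v} → T (S v) → v ∈ F)
               (branching : ∀ {v} → T (S v) → 2 ≤ count (links ⁅ v ⁆ᵇ (S ∪ᵇ R))) where

        branching-no-exit : ∀ {i u r} → Joins G i u r → T (S u) → T (R r) → ⊥
        branching-no-exit {i} {u} {r} J u∈S r∈R =
          two-exits (Joins-endpoints J (subst (λ i → Joins G i vertex target) (sym i≡edge) joins))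
          where
          open Walk forest S R S⊆F branching u i
          open Exit (escape u∈S)
          i≡edge : i ≡ edge
          i≡edge = unique-exit u (S⊆F u∈S) i edge
            (u      , r      , J     , (S⊆F u∈S      , here)    , R⇒∉C r∈R      , R⇒∉F r∈R)
            (vertex , target , joins , (S⊆F vertex∈S , reaches) , R⇒∉C target∈Z , R⇒∉F target∈Z)
          two-exits : (u ≡ vertex × r ≡ target) ⊎ (u ≡ target × r ≡ vertex) → ⊥
          two-exits (inj₁ (u≡vertex , _)) = fresh (sym u≡vertex) (sym i≡edge)
          two-exits (inj₂ (u≡target , _)) = R⇒∉F target∈Z (subst (_∈ F) u≡target (S⊆F u∈S))

        branching-empty : ∀ {v} → ¬ T (S v)
        branching-empty {v} v∈S = branching-no-exit joins vertex∈S target∈Z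
          where
          -- any edge serves as the forbidden one
          open Walk forest S R S⊆F branching v (proj₁ (count-witness _ (≤-trans (s≤s z≤n) (branching v∈S))))
          open Exit (escape v∈S)

      links-bound : ∀ k (S : Vertex → Bool) → count S ≡ k → (∀ {v} → T (S v) → v ∈ F) →
                    count (links S (S ∪ᵇ R)) ≤ k
      links-bound zero S |S|≡0 S⊆F = ≮⇒≥ λ pos →
        let i , ℓ = count-witness (links S (S ∪ᵇ R)) pos
            _ , _ , _ , a∈S , _ = links⇒Joins {S} {S ∪ᵇ R} ℓ
        in n≮0 (subst (0 <_) |S|≡0 (T⇒0<count S a∈S))
      links-bound (suc k) S |S|≡1+k S⊆F
        with any? (λ v → T? (S v) ×-dec (count (links ⁅ v ⁆ᵇ (S ∪ᵇ R)) ≤? 1))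
      ... | yes (v , v∈S , leaf) = begin
        count (links S (S ∪ᵇ R))
          ≤⟨ count-≤-+ (links S (S ∪ᵇ R)) _ _ (links-∖ S R ⁅ v ⁆ᵇ) ⟩
        count (links (S ∖ᵇ ⁅ v ⁆ᵇ) ((S ∖ᵇ ⁅ v ⁆ᵇ) ∪ᵇ R)) + count (links ⁅ v ⁆ᵇ (S ∪ᵇ R))
          ≤⟨ +-mono-≤ (links-bound k (S ∖ᵇ ⁅ v ⁆ᵇ) |S-v|≡k (S⊆F ∘ proj₁ ∘ to T-∧)) leaf ⟩
        k + 1
          ≡⟨ +-comm k 1 ⟩
        suc k ∎
        where
        open ≤-Reasoning
        |S-v|≡k : count (S ∖ᵇ ⁅ v ⁆ᵇ) ≡ k
        |S-v|≡k = suc-injective (trans (sym (count-remove S v∈S)) |S|≡1+k)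
      ... | no no-leaf = ⊥-elim (branching-empty S S⊆F
              (λ {v} v∈S → ≰⇒> λ ≤1 → no-leaf (v , v∈S , ≤1))
              (proj₂ (count-witness S (subst (0 <_) (sym |S|≡1+k) (s≤s z≤n)))))

    endpoints-bound :
      sumFin (λ i → indicator (lookup F (end₁ i)) + indicator (lookup F (end₂ i))) ≤
      2 * count (links (lookup F) (lookup F ∪ᵇ R)) + eBetween G C F
    endpoints-bound = begin
      sumFin (λ i → indicator (lookup F (end₁ i)) + indicator (lookup F (end₂ i)))
        ≤⟨ sumFin-mono per-edge ⟩
      sumFin (λ i → 2 * indicator (inner i) + indicator (cut i))
        ≡⟨ sumFin-+ (λ i → 2 * indicator (inner i)) (indicator ∘ cut) ⟩
      sumFin (λ i → 2 * indicator (inner i)) + sumFin (indicator ∘ cut)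
        ≡⟨ cong₂ _+_ (trans (sumFin-*ˡ 2 (indicator ∘ inner)) (cong (2 *_) (sym (count≡sumFin inner))))
                     (sym (count≡sumFin cut)) ⟩
      2 * count inner + eBetween G C F ∎
      where
      open ≤-Reasoning
      inner cut : Edge → Bool
      inner = links (lookup F) (lookup F ∪ᵇ R)
      cut i = (lookup C (end₁ i) ∧ lookup F (end₂ i)) ∨ (lookup F (end₁ i) ∧ lookup C (end₂ i))
      table : Vec Bool 4 → Bool
      table (f₁ ∷ f₂ ∷ c₁ ∷ c₂ ∷ []) =
        indicator f₁ + indicator f₂ ≤ᵇ
        2 * indicator (link f₁ f₂ (f₁ ∨ (not c₁ ∧ not f₁)) (f₂ ∨ (not c₂ ∧ not f₂))) +
        indicator ((c₁ ∧ f₂) ∨ (f₁ ∧ c₂))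
      per-edge : ∀ i → indicator (lookup F (end₁ i)) + indicator (lookup F (end₂ i)) ≤
                       2 * indicator (inner i) + indicator (cut i)
      per-edge i = ≤ᵇ⇒≤ _ _ (tautology⇒T 4 table _
        (lookup F (end₁ i) ∷ lookup F (end₂ i) ∷ lookup C (end₁ i) ∷ lookup C (end₂ i) ∷ []))

lemma19 : (G : Multigraph) → (∀ v → 3 ≤ degree G v) →
    (C F : Subset (n G)) → IsFVC G C F → ∣ F ∣ ≤ eBetween G C F
lemma19 G δ≥3 C F (_ , forest , unique-exit) = begin
  ∣ F ∣          ≡⟨ ∣p∣≡count F ⟩
  s              ≤⟨ +-cancelʳ-≤ (2 * s) s (eBetween G C F) three-s≤ ⟩
  eBetween G C F ∎
  where
  open Graph G
  open Cut C F
  open ≤-Reasoning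
  s : ℕ
  s = count (lookup F)
  three-s≤ : 3 * s ≤ eBetween G C F + 2 * s
  three-s≤ = begin
    3 * s
      ≤⟨ *-count-≤ 3 (lookup F) (degree G) (λ v _ → δ≥3 v) ⟩
    sumFin (λ v → if lookup F v then degree G v else 0)
      ≡⟨ handshake (lookup F) ⟩
    sumFin (λ i → indicator (lookup F (end₁ i)) + indicator (lookup F (end₂ i)))
      ≤⟨ endpoints-bound ⟩
    2 * count (links (lookup F) (lookup F ∪ᵇ R)) + eBetween G C F
      ≤⟨ +-monoˡ-≤ _ (*-monoʳ-≤ 2 (links-bound forest unique-exit s (lookup F) refl T⇒∈)) ⟩
    2 * s + eBetween G C F
      ≡⟨ +-comm (2 * s) _ ⟩
    eBetween G C F + 2 * s ∎
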